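{- Let $\mathcal{GO}=\langle t,\prec,\phi\rangle$ be a GOMT problem with $\phi$ satisfiable. Every element of the solution sequence of a $\mathcal{GO}$-derivation is $\mathcal{GO}$-consistent, i.e., satisfies $\phi$.
   Context: Fix a many-sorted first-order theory $\mathcal{T}$ with signature $\Sigma$; interpretations are $\mathcal{T}$-interpretations assigning values to all variables, and $\models$ means $\models_{\mathcal{T}}$. A GOMT problem is $\mathcal{GO}=\langle t,\prec,\phi\rangle$: $t$ a $\Sigma$-term of sort $\sigma$, $\prec$ a strict partial order on values of sort $\sigma$ definable in $\mathcal{T}$, $\phi$ a $\Sigma$-formula. $\mathcal{I}$ is $\mathcal{GO}$-consistent if $\mathcal{I}\models\phi$; $\mathcal{I}<_{\mathcal{GO}}\mathcal{I}'$ if both are $\mathcal{GO}$-consistent and $t^{\mathcal{I}}\prec t^{\mathcal{I}'}$. $\textsc{Solve}$ maps a formula to an interpretation satisfying it if satisfiable, else to $\bot$. $\textsc{Better}$ maps each $\mathcal{GO}$-consistent $\mathcal{I}$ to a formula with: for every $\mathcal{GO}$-consistent $\mathcal{I}'$, $\mathcal{I}'\models\textsc{Better}(\mathcal{I})$ iff $\mathcal{I}'<_{\mathcal{GO}}\mathcal{I}$. $\textsc{Top}(s_1,\dots,s_n)=s_1$, $\textsc{Pop}(s_1,\dots,s_n)=(s_2,\dots,s_n)$, $\emptyset$ the empty sequence, $\circ$ concatenation. A state is $\langle\mathcal{I},\Delta,\tau\rangle$ (interpretation, formula, finite sequence of formulas). Initial state: $\mathcal{I}_0=\textsc{Solve}(\phi)$,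 $\Delta_0=\textsc{Better}(\mathcal{I}_0)$, $\tau_0=(\Delta_0)$. Rules (unmentioned components unchanged): F-Split: if $\tau\neq\emptyset$, $\psi=\textsc{Top}(\tau)$, $\phi\models\psi\Leftrightarrow\bigvee_{j=1}^k\psi_j$, $k\ge1$, then $\tau:=(\psi_1,\dots,\psi_k)\circ\textsc{Pop}(\tau)$. F-Sat: if $\tau\neq\emptyset$, $\psi=\textsc{Top}(\tau)$, $\textsc{Solve}(\phi\wedge\psi)=\mathcal{I}'\neq\bot$, $\Delta'=\Delta\wedge\textsc{Better}(\mathcal{I}')$, then $\mathcal{I}:=\mathcal{I}'$, $\Delta:=\Delta'$, $\tau:=(\Delta')$. F-Close: if $\tau\neq\emptyset$, $\psi=\textsc{Top}(\tau)$, $\textsc{Solve}(\phi\wedge\psi)=\bot$, then $\Delta:=\Delta\wedge\neg\psi$, $\tau:=\textsc{Pop}(\tau)$. A rule applies if its premises hold and the resulting state differs. A $\mathcal{GO}$-derivation is a sequence of states starting at the initial state, each obtained from the previous by one rule; its solution sequence is the sequence of the interpretation components of its states. -}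

module Defs where

open import Level using (0ℓ)
open import Data.Nat using (ℕ; suc)
open import Data.Fin using (Fin; zero; suc; inject₁)
open import Data.List using (List; []; _∷_; _++_)
open import Data.List.Relation.Unary.Any using (Any)
open import Data.Maybe using (Maybe; just; nothing)
open import Data.Product using (_×_; ∃)
open import Function.Bundles using (_⇔_)
open import Relation.Binary.Core using (Rel)
open import Relation.Binary.Structures using (IsStrictPartialOrder)
open import Relation.Binary.PropositionalEquality using (_≡_; _≢_)
open import Relation.Nullary using (¬_)

-- A (many-sorted first-order) theory T, given semantically:
-- Interp = the T-interpretations (assigning values to all variables),
-- Formula = the Σ-formulas, _⊨_ = ⊨_T, with the connectives used by the
-- procedure and their standard semantics.
record Theory : Set₁ where
  infix 4 _⊨_
  infixr 6 _∧_
  field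
    Interp  : Set
    Formula : Set
    _⊨_     : Interp → Formula → Set
    _∧_     : Formula → Formula → Formula
    ¬f_     : Formula → Formula
    ⊨-∧     : ∀ I φ ψ → (I ⊨ (φ ∧ ψ)) ⇔ (I ⊨ φ × I ⊨ ψ)
    ⊨-¬     : ∀ I φ → (I ⊨ (¬f φ)) ⇔ (¬ (I ⊨ φ))

  Satisfiable : Formula → Set
  Satisfiable φ = ∃ λ I → I ⊨ φ

record IsSolve (T : Theory) (solve : Theory.Formula T → Maybe (Theory.Interp T)) : Set where
  open Theory T
  field
    solve-sat   : ∀ ψ I → solve ψ ≡ just I → I ⊨ ψ
    solve-unsat : ∀ ψ → solve ψ ≡ nothing → ∀ I → ¬ (I ⊨ ψ)

-- A GOMT problem ⟨t, ≺, φ⟩: the term t of sort σ is given by its value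
-- in each interpretation (t^I ∈ Val = domain of σ).
record GOMT (T : Theory) : Set₁ where
  open Theory T
  field
    Val    : Set
    term   : Interp → Val
    _≺_    : Rel Val 0ℓ
    ≺-spo  : IsStrictPartialOrder _≡_ _≺_
    φ      : Formula

  Consistent : Interp → Set
  Consistent I = I ⊨ φ

  _<GO_ : Interp → Interp → Set
  I <GO I' = Consistent I × Consistent I' × (term I ≺ term I')

record IsBetter {T : Theory} (GO : GOMT T) (better : Theory.Interp T → Theory.Formula T) : Set where
  open Theory T
  open GOMT GO
  field
    better-spec : ∀ I I' → Consistent I → Consistent I' → (I' ⊨ better I) ⇔ (I' <GO I)

module Calculus {T : Theory} (GO : GOMT T)
                (solve : Theory.Formula T → Maybe (Theory.Interp T))
                (better : Theory.Interp T → Theory.Formula T) where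
  open Theory T
  open GOMT GO

  record State : Set where
    constructor ⟨_,_,_⟩
    field
      interp : Interp
      Δ      : Formula
      τ      : List Formula
  open State public

  initial : Interp → State
  initial I₀ = ⟨ I₀ , better I₀ , better I₀ ∷ [] ⟩

  -- one rule application; each rule requires the resulting state to differ
  data Step : State → State → Set where
    F-Split : ∀ {I Δ ψ rest} (ψs : List Formula) →
              ψs ≢ [] →
              (∀ J → J ⊨ φ → (J ⊨ ψ) ⇔ Any (J ⊨_) ψs) →
              ⟨ I , Δ , ψ ∷ rest ⟩ ≢ ⟨ I , Δ , ψs ++ rest ⟩ →
              Step ⟨ I , Δ , ψ ∷ rest ⟩ ⟨ I , Δ , ψs ++ rest ⟩
    F-Sat   : ∀ {I Δ ψ rest} I′ →
              solve (φ ∧ ψ) ≡ just I′ →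
              ⟨ I , Δ , ψ ∷ rest ⟩ ≢ ⟨ I′ , Δ ∧ better I′ , (Δ ∧ better I′) ∷ [] ⟩ →
              Step ⟨ I , Δ , ψ ∷ rest ⟩ ⟨ I′ , Δ ∧ better I′ , (Δ ∧ better I′) ∷ [] ⟩
    F-Close : ∀ {I Δ ψ rest} →
              solve (φ ∧ ψ) ≡ nothing →
              ⟨ I , Δ , ψ ∷ rest ⟩ ≢ ⟨ I , Δ ∧ (¬f ψ) , rest ⟩ →
              Step ⟨ I , Δ , ψ ∷ rest ⟩ ⟨ I , Δ ∧ (¬f ψ) , rest ⟩

  record Derivation (I₀ : Interp) (n : ℕ) : Set where
    field
      state : Fin (suc n) → State
      start : state zero ≡ initial I₀
      step  : (i : Fin n) → Step (state (inject₁ i)) (state (suc i))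

  solutions : ∀ {I₀ n} → Derivation I₀ n → Fin (suc n) → Interp
  solutions d i = interp (Derivation.state d i)

module Submission where

open import Defs
open import Data.Nat using (ℕ; suc)
open import Data.Fin using (Fin)
open import Data.Fin.Induction using (<-weakInduction)
open import Data.Maybe using (Maybe; just)
open import Data.Product using (proj₁)
open import Function.Bundles using (Equivalence)
open import Relation.Binary.PropositionalEquality using (_≡_; subst; sym)

-- φ is an invariant of the calculus: the only rule that changes the
-- interpretation is F-Sat, whose new model satisfies φ ∧ ψ.

module Invariant {T : Theory} (GO : GOMT T)
                 {solve : Theory.Formula T → Maybe (Theory.Interp T)}
                 (better : Theory.Interp T → Theory.Formula T)
                 (isSolve : IsSolve T solve) where
  open Theory T
  open GOMT GO
  open Calculus GO solve better
  open IsSolve isSolve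

  Step-preserves-Consistent : ∀ {s s′} → Step s s′ →
                              Consistent (interp s) → Consistent (interp s′)
  Step-preserves-Consistent (F-Split _ _ _ _)           c = c
  Step-preserves-Consistent (F-Close _ _)               c = c
  Step-preserves-Consistent (F-Sat {ψ = ψ} I′ solved _) _ =
    proj₁ (Equivalence.to (⊨-∧ I′ φ ψ) (solve-sat (φ ∧ ψ) I′ solved))

  Derivation-consistent : ∀ {I₀ n} → Consistent I₀ → (d : Derivation I₀ n) →
                          ∀ i → Consistent (solutions d i)
  Derivation-consistent c₀ d =
    <-weakInduction (λ i → Consistent (solutions d i)) consistent-start
      (λ i → Step-preserves-Consistent (step i))
    where
    open Derivation d
    consistent-start : Consistent (interp (state _))
    consistent-start = subst (λ s → Consistent (interp s)) (sym start) c₀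

lemma1 : (T : Theory) (GO : GOMT T)
         (solve : Theory.Formula T → Maybe (Theory.Interp T))
         (better : Theory.Interp T → Theory.Formula T) →
         IsSolve T solve → IsBetter GO better →
         Theory.Satisfiable T (GOMT.φ GO) →
         (I₀ : Theory.Interp T) → solve (GOMT.φ GO) ≡ just I₀ →
         (n : ℕ) (d : Calculus.Derivation GO solve better I₀ n) (i : Fin (suc n)) →
         GOMT.Consistent GO (Calculus.solutions GO solve better d i)
lemma1 T GO solve better isSolve _ _ I₀ solved n d =
  Derivation-consistent (IsSolve.solve-sat isSolve (GOMT.φ GO) I₀ solved) d
  where open Invariant GO better isSolve
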